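{- Let $\vec\alpha\,F$ be an $n$-ary BNF and $\sim$ a type-polymorphic family of relations on $\vec\alpha\,F$ which at every type is an equivalence relation and which satisfies $x\sim y\Rightarrow\mathrm{map}_F\,\vec f\,x\sim\mathrm{map}_F\,\vec f\,y$ for all $\vec f$. Then for all sets $\vec A$, $$F^{\sim}_{\mathrm{in}}\,\vec A=\{x\mid[\mathrm{map}_F\,\vec{\mathfrak e}\,x]_\sim\in[F_{\mathrm{in}}\,\overrightarrow{(\{\circledast\}\cup\mathfrak e\langle A\rangle)}]_\sim\},$$ where on the right $\sim$ is the instance at type $\overrightarrow{(\mathsf 1+\alpha)}\,F$.
   Context: HOL setting (all types non-empty); vector notation $\vec x=x_1,\dots,x_n$ with synchronized indices. An $n$-ary BNF is a type constructor $\vec\alpha\,F$ with polymorphic mapper $\mathrm{map}_F::(\alpha_1\to\beta_1)\to\cdots\to(\alpha_n\to\beta_n)\to\vec\alpha\,F\to\vec\beta\,F$, setters $\mathrm{set}_{F,i}::\vec\alpha\,F\to\alpha_i\ \mathrm{set}$, infinite cardinal bound $\mathrm{bd}_F$, relator $\mathrm{rel}_F$, satisfying: $\mathrm{map}_F\,\vec{\mathrm{id}}=\mathrm{id}$; $\mathrm{map}_F\,\vec g\circ\mathrm{map}_F\,\vec f=\mathrm{map}_F\,\overrightarrow{(g\circ f)}$; $\mathrm{set}_{F,i}(\mathrm{map}_F\,\vec f\,x)=f_i\langle\mathrm{set}_{F,i}\,x\rangle$ (image); if $f_i z=g_i z$ for all $i$ and $z\in\mathrm{set}_{F,i}\,x$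 then $\mathrm{map}_F\,\vec f\,x=\mathrm{map}_F\,\vec g\,x$; $|\mathrm{set}_{F,i}\,x|\le\mathrm{bd}_F$; $(x,y)\in\mathrm{rel}_F\,\vec R$ iff some $z$ has $\mathrm{set}_{F,i}\,z\subseteq R_i$ for all $i$, $\mathrm{map}_F\,\overrightarrow{\mathrm{fst}}\,z=x$, $\mathrm{map}_F\,\overrightarrow{\mathrm{snd}}\,z=y$; $\mathrm{rel}_F\,\vec R\bullet\mathrm{rel}_F\,\vec S\subseteq\mathrm{rel}_F\,\overrightarrow{(R\bullet S)}$ ($\bullet$ = relation composition). Notation: $F_{\mathrm{in}}\,\vec A=\{x\mid\forall i.\ \mathrm{set}_{F,i}\,x\subseteq A_i\}$; $[x]_\sim=\{y\mid x\sim y\}$, $[A]_\sim=\{[x]_\sim\mid x\in A\}$; $\mathsf 1+\alpha$ is the sum of the unit type and $\alpha$, with $\circledast$ the left injection of the unit element and $\mathfrak e::\alpha\to\mathsf 1+\alpha$ the right injection. Define $F^{\sim}_{\mathrm{in}}\,\vec A=\{x\mid\forall\vec f\,\vec g.\ (\forall i.\ \forall a\in A_i.\ f_i\,a=g_i\,a)\longrightarrow\mathrm{map}_F\,\vec f\,x\sim\mathrm{map}_F\,\vec g\,x\}$ with $f_i,g_i::\alpha_i\to\mathsf 1+\alpha_i$. -}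

module Defs where

open import Data.Nat using (ℕ)
open import Data.Fin using (Fin)
open import Data.Unit using (⊤; tt)
open import Data.Sum using (_⊎_; inj₁; inj₂)
open import Data.Product using (Σ; ∃; _×_; _,_; proj₁; proj₂)
open import Data.Bool using (Bool; true)
open import Function using (_∘_; id)
open import Relation.Binary.PropositionalEquality using (_≡_)
open import Relation.Binary.Structures using (IsEquivalence)

Types : ℕ → Set₁
Types n = Fin n → Set

-- A HOL set over a type: a boolean predicate (HOL: α set ≅ α → bool).
HSet : Set → Set
HSet A = A → Bool

_⇔_ : Set → Set → Set
P ⇔ Q = (P → Q) × (Q → P)

Rels : ∀ {n} → Types n → Types n → Set₁
Rels α β = ∀ i → α i → β i → Set

_•_ : ∀ {n} {α β γ : Types n} → Rels α β → Rels β γ → Rels α γ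
(R • S) i a c = ∃ λ b → R i a b × S i b c

Pairs : ∀ {n} → Types n → Types n → Types n
Pairs α β i = α i × β i

record BNF (n : ℕ) : Set₁ where
  field
    F    : Types n → Set
    map  : ∀ {α β : Types n} → (∀ i → α i → β i) → F α → F β
    set  : ∀ {α : Types n} (i : Fin n) → F α → α i → Set
    -- the cardinal bound bd_F, represented by a type
    Bd   : Set
    rel  : ∀ {α β : Types n} → Rels α β → F α → F β → Set

    map-id   : ∀ {α : Types n} (x : F α) → map (λ i → id) x ≡ x
    map-comp : ∀ {α β γ : Types n} (f : ∀ i → α i → β i) (g : ∀ i → β i → γ i)
               (x : F α) → map g (map f x) ≡ map (λ i → g i ∘ f i) x
    set-map  : ∀ {α β : Types n} (f : ∀ i → α i → β i) (x : F α) (i : Fin n) (b : β i) →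
               set i (map f x) b ⇔ (∃ λ a → set i x a × f i a ≡ b)
    map-cong : ∀ {α β : Types n} (f g : ∀ i → α i → β i) (x : F α) →
               (∀ i a → set i x a → f i a ≡ g i a) → map f x ≡ map g x
    -- bd_F is infinite: ℕ injects into it
    bd-inf   : Σ (ℕ → Bd) λ h → ∀ m k → h m ≡ h k → m ≡ k
    -- |set_{F,i} x| ≤ bd_F : the set injects into bd_F
    set-bd   : ∀ {α : Types n} (i : Fin n) (x : F α) →
               Σ (Σ (α i) (set i x) → Bd) λ h → ∀ p q → h p ≡ h q → p ≡ q
    rel-def  : ∀ {α β : Types n} (R : Rels α β) (x : F α) (y : F β) →
               rel R x y ⇔
               (∃ λ (z : F (Pairs α β)) →
                  (∀ i p → set i z p → R i (proj₁ p) (proj₂ p))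
                  × map (λ i → proj₁) z ≡ x × map (λ i → proj₂) z ≡ y)
    rel-comp : ∀ {α β γ : Types n} (R : Rels α β) (S : Rels β γ)
               (x : F α) (y : F β) (z : F γ) →
               rel R x y → rel S y z → rel (R • S) x z

module _ {n : ℕ} (B : BNF n) where
  open BNF B

  record MapCompatEquiv : Set₁ where
    field
      _∼_      : ∀ {α : Types n} → F α → F α → Set
      ∼-equiv  : ∀ {α : Types n} → IsEquivalence (_∼_ {α})
      ∼-map    : ∀ {α β : Types n} (f : ∀ i → α i → β i) {x y : F α} →
                 x ∼ y → map f x ∼ map f y

  -- 1 + α, with ⊛ = inj₁ tt and 𝔢 = inj₂
  Opt : Types n → Types n
  Opt α i = ⊤ ⊎ α i

  Fin-in : ∀ {α : Types n} → (∀ i → HSet (α i)) → F α → Set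
  Fin-in A x = ∀ i a → set i x a → A i a ≡ true

  StarUnion : ∀ {α : Types n} → (∀ i → HSet (α i)) → ∀ i → HSet (Opt α i)
  StarUnion A i (inj₁ _) = true
  StarUnion A i (inj₂ a) = A i a

  module _ (E : MapCompatEquiv) where
    open MapCompatEquiv E

    Fsim-in : ∀ {α : Types n} → (∀ i → HSet (α i)) → F α → Set
    Fsim-in {α} A x = ∀ (f g : ∀ i → α i → Opt α i) →
      (∀ i a → A i a ≡ true → f i a ≡ g i a) → map f x ∼ map g x

    Class : ∀ {α : Types n} → F α → F α → Set
    Class x z = x ∼ z

    -- C ∈ [S]_∼ : some y ∈ S has [y]_∼ = C (extensional set equality)
    InClasses : ∀ {α : Types n} → (F α → Set) → (F α → Set) → Set
    InClasses C S = ∃ λ y → S y × (∀ z → Class y z ⇔ C z)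

    RHS : ∀ {α : Types n} → (∀ i → HSet (α i)) → F α → Set
    RHS A x = InClasses (Class (map (λ i → inj₂) x)) (Fin-in (StarUnion A))

module Submission where

open import Defs
open import Data.Nat using (ℕ)
open import Data.Unit using (tt)
open import Data.Sum using (inj₁; inj₂)
open import Data.Product using (∃; _×_; _,_; proj₁; proj₂)
open import Data.Bool using (true; false; if_then_else_)
open import Relation.Binary.PropositionalEquality using (_≡_; refl; subst)
open import Relation.Binary.Bundles using (Setoid)
open import Relation.Binary.Structures using (IsEquivalence)
import Relation.Binary.Reasoning.Setoid as SetoidReasoning

-- The class of map 𝔢 x meets F_in({⊛} ∪ 𝔢⟨A⟩) exactly when x can be cut down to
-- A: forwards, map 𝔢 x ∼ map r x for the restriction r sending A to 𝔢 and the
-- rest to ⊛, because r agrees with 𝔢 on A; backwards, any f, g agreeing on A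
-- extend (by ⊛ ↦ ⊛) to maps that agree on {⊛} ∪ 𝔢⟨A⟩, so they coincide on a
-- representative y lying there, and transporting along map 𝔢 x ∼ y gives
-- map f x ∼ map g x.

module _ {n : ℕ} (B : BNF n) where
  open BNF B

  map-Fin-in : ∀ {α β : Types n} {f : ∀ i → α i → β i} {C : ∀ i → HSet (β i)} (x : F α) →
               (∀ i a → set i x a → C i (f i a) ≡ true) → Fin-in B C (map f x)
  map-Fin-in {f = f} x f∈C i b b∈ with proj₁ (set-map f x i b) b∈
  ... | a , a∈ , refl = f∈C i a a∈

  map-cong-Fin-in : ∀ {α β : Types n} {C : ∀ i → HSet (α i)} (f g : ∀ i → α i → β i) {y : F α} →
                    Fin-in B C y → (∀ i a → C i a ≡ true → f i a ≡ g i a) → map f y ≡ map g y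
  map-cong-Fin-in f g {y} y∈ f≗g = map-cong f g y λ i a a∈ → f≗g i a (y∈ i a a∈)

  restrict : ∀ {α : Types n} → (∀ i → HSet (α i)) → ∀ i → α i → Opt B α i
  restrict A i a = if A i a then inj₂ a else inj₁ tt

  restrict-agrees : ∀ {α : Types n} (A : ∀ i → HSet (α i)) i (a : α i) →
                    A i a ≡ true → inj₂ a ≡ restrict A i a
  restrict-agrees A i a A∋a rewrite A∋a = refl

  restrict-StarUnion : ∀ {α : Types n} (A : ∀ i → HSet (α i)) i (a : α i) →
                       StarUnion B A i (restrict A i a) ≡ true
  restrict-StarUnion A i a with A i a in A∋a
  ... | true  = A∋a
  ... | false = refl

  extend : ∀ {α β : Types n} → (∀ i → α i → Opt B β i) → ∀ i → Opt B α i → Opt B β i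
  extend f i (inj₁ _) = inj₁ tt
  extend f i (inj₂ a) = f i a

  extend-agrees : ∀ {α β : Types n} (A : ∀ i → HSet (α i)) (f g : ∀ i → α i → Opt B β i) →
                  (∀ i a → A i a ≡ true → f i a ≡ g i a) →
                  ∀ i u → StarUnion B A i u ≡ true → extend f i u ≡ extend g i u
  extend-agrees A f g f≗g i (inj₁ _) _   = refl
  extend-agrees A f g f≗g i (inj₂ a) A∋a = f≗g i a A∋a

  map-extend-inj₂ : ∀ {α β : Types n} (f : ∀ i → α i → Opt B β i) (x : F α) →
                    map (extend f) (map (λ i → inj₂) x) ≡ map f x
  map-extend-inj₂ f x = map-comp (λ i → inj₂) (extend f) x

  module _ (E : MapCompatEquiv B) where
    open MapCompatEquiv E

    module ∼ {α : Types n} = IsEquivalence (∼-equiv {α})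

    ∼-setoid : Types n → Setoid _ _
    ∼-setoid α = record { Carrier = F α ; _≈_ = _∼_ ; isEquivalence = ∼-equiv }

    InClasses-Class⇔ : ∀ {α : Types n} (x : F α) (S : F α → Set) →
                       InClasses B E (Class B E x) S ⇔ (∃ λ y → S y × x ∼ y)
    InClasses-Class⇔ x S = to , from
      where
      to : InClasses B E (Class B E x) S → ∃ λ y → S y × x ∼ y
      to (y , y∈S , [y]≡[x]) = y , y∈S , ∼.sym (proj₂ ([y]≡[x] x) ∼.refl)
      from : (∃ λ y → S y × x ∼ y) → InClasses B E (Class B E x) S
      from (y , y∈S , x∼y) = y , y∈S , λ z → ∼.trans x∼y , ∼.trans (∼.sym x∼y)

    map-extend-∼ : ∀ {α β : Types n} (f : ∀ i → α i → Opt B β i) {x : F α} {y : F (Opt B α)} →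
                   map (λ i → inj₂) x ∼ y → map f x ∼ map (extend f) y
    map-extend-∼ f {x} {y} 𝔢x∼y =
      subst (_∼ map (extend f) y) (map-extend-inj₂ f x) (∼-map (extend f) 𝔢x∼y)

    module _ {α : Types n} (A : ∀ i → HSet (α i)) (x : F α) where

      Fsim-in⇒RHS : Fsim-in B E A x → RHS B E A x
      Fsim-in⇒RHS x∈ = proj₂ (InClasses-Class⇔ _ _)
        ( map (restrict A) x
        , map-Fin-in x (λ i a _ → restrict-StarUnion A i a)
        , x∈ (λ i → inj₂) (restrict A) (restrict-agrees A) )

      RHS⇒Fsim-in : RHS B E A x → Fsim-in B E A x
      RHS⇒Fsim-in rhs f g f≗g with proj₁ (InClasses-Class⇔ _ _) rhs
      ... | y , y∈ , 𝔢x∼y = begin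
        map f x           ≈⟨ map-extend-∼ f 𝔢x∼y ⟩
        map (extend f) y  ≡⟨ map-cong-Fin-in (extend f) (extend g) y∈ (extend-agrees A f g f≗g) ⟩
        map (extend g) y  ≈⟨ map-extend-∼ g 𝔢x∼y ⟨
        map g x           ∎
        where open SetoidReasoning (∼-setoid (Opt B α))

lemma3p5 : ∀ {n : ℕ} (B : BNF n) (E : MapCompatEquiv B) {α : Types n}
    (A : ∀ i → HSet (α i)) (x : BNF.F B α) →
    Fsim-in B E A x ⇔ RHS B E A x
lemma3p5 B E A x = Fsim-in⇒RHS B E A x , RHS⇒Fsim-in B E A x
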